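{- Let $D=(E,\mathcal{F})$ be a set system with $\mathcal{F}\neq\emptyset$. Then there exists a feasible set $F\in\mathcal{F}$ such that \[ \omega(D\,\Delta\, F)=\partial\omega_M(D). \]
   Context: A set system is a pair $D=(E,\mathcal{F})$ where $E$ is a finite set (the ground set) and $\mathcal{F}$ is a collection of subsets of $E$ (the feasible sets). For $A\subseteq E$, the twist of $D$ with respect to $A$ is the set system $D\,\Delta\, A=(E,\{X\,\Delta\, A: X\in\mathcal{F}\})$, where $X\,\Delta\, A=(X\cup A)\setminus(X\cap A)$ is the symmetric difference. Let $r_{\max}(D)$ and $r_{\min}(D)$ denote the maximum and minimum cardinality of a feasible set of $D$. The width of $D$ is $\omega(D)=r_{\max}(D)-r_{\min}(D)$. The maximum twist width of $D$ is $\partial\omega_M(D)=\max\{\omega(D\,\Delta\, A): A\subseteq E\}$. -}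

module Defs where

open import Data.Nat using (ℕ; zero; suc; _∸_; _⊔_; _⊓_)
open import Data.Bool using (true; false)
open import Data.List using (List; []; _∷_; map; foldr; _++_)
open import Data.Vec using (_∷_; [])
open import Data.Fin.Subset using (Subset; _∪_; _∩_; _─_; ∣_∣)

-- A set system on the ground set E = Fin n: its family of feasible sets,
-- given as a finite list of subsets (repetitions are irrelevant).
record SetSystem (n : ℕ) : Set where
  constructor setSystem
  field
    feasible : List (Subset n)
open SetSystem public

_Δ_ : ∀ {n} → Subset n → Subset n → Subset n
X Δ A = (X ∪ A) ─ (X ∩ A)

twist : ∀ {n} → SetSystem n → Subset n → SetSystem n
twist D A = setSystem (map (λ X → X Δ A) (feasible D))

-- maximum / minimum cardinality of a feasible set
-- (only meaningful when the family is nonempty; the value 0 on the empty family is a convention)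
rmax : ∀ {n} → SetSystem n → ℕ
rmax D = foldr (λ X m → ∣ X ∣ ⊔ m) 0 (feasible D)

rminList : ∀ {n} → List (Subset n) → ℕ
rminList []       = 0
rminList (X ∷ Xs) = foldr (λ Y m → ∣ Y ∣ ⊓ m) ∣ X ∣ Xs

rmin : ∀ {n} → SetSystem n → ℕ
rmin D = rminList (feasible D)

ω : ∀ {n} → SetSystem n → ℕ
ω D = rmax D ∸ rmin D

allSubsets : ∀ n → List (Subset n)
allSubsets zero    = [] ∷ []
allSubsets (suc n) = map (true ∷_) (allSubsets n) ++ map (false ∷_) (allSubsets n)

∂ωM : ∀ {n} → SetSystem n → ℕ
∂ωM {n} D = foldr (λ A m → ω (twist D A) ⊔ m) 0 (allSubsets n)

{-# OPTIONS --safe #-}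
module Submission where

-- ∣ X Δ Y ∣ is the Hamming distance, and ω (D Δ A) is the gap between the
-- farthest and the nearest feasible set from A. Take F ∈ ℱ of maximal
-- eccentricity e(F) = max { ∣ X Δ F ∣ : X ∈ ℱ }; since F is at distance 0
-- from itself, ω (D Δ F) = e(F). For any A, let Y ∈ ℱ be nearest to A: by the
-- triangle inequality ∣ X Δ A ∣ ≤ e(Y) + ∣ Y Δ A ∣ for all X ∈ ℱ, hence
-- ω (D Δ A) ≤ e(Y) ≤ e(F).

open import Defs
open import Data.Nat using (ℕ)
open import Data.List using ([])
open import Data.List.Membership.Propositional using (_∈_)
open import Data.Product using (∃-syntax; _×_)
open import Relation.Binary.PropositionalEquality using (_≡_; _≢_)

open import Data.Nat using (_+_; _∸_; _⊔_; _⊓_; _≤_; z≤n; s≤s)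
open import Data.Nat.Properties
open import Data.Bool using (true; false)
open import Data.Vec using ([]; _∷_)
open import Data.List using (List; _∷_; map; foldr)
open import Data.List.Properties using (foldr-map)
open import Data.List.Relation.Unary.Any using (here; there)
open import Data.List.Relation.Unary.All using (tabulate; lookup)
open import Data.List.Membership.Propositional.Properties
  using (∈-++⁺ˡ; ∈-++⁺ʳ; ∈-map⁺; ∈-map⁻; foldr-selective)
open import Data.List.Extrema.Nat using (argmax; f[⊥]≤f[argmax]; f[xs]≤f[argmax]; argmax-all)
open import Data.Fin.Subset using (Subset; _⊆_; _∪_; ∣_∣)
open import Data.Fin.Subset.Properties using (out⊆; in⊆in; p⊆q⇒∣p∣≤∣q∣)
open import Data.Product using (_,_)
open import Data.Sum using (inj₁; inj₂)
open import Data.Empty using (⊥-elim)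
open import Function using (_∘_)
open import Relation.Binary.PropositionalEquality using (refl; sym; trans; cong₂)

∣pΔp∣≡0 : ∀ {n} (p : Subset n) → ∣ p Δ p ∣ ≡ 0
∣pΔp∣≡0 []          = refl
∣pΔp∣≡0 (true  ∷ p) = ∣pΔp∣≡0 p
∣pΔp∣≡0 (false ∷ p) = ∣pΔp∣≡0 p

∣p∪q∣≤∣p∣+∣q∣ : ∀ {n} (p q : Subset n) → ∣ p ∪ q ∣ ≤ ∣ p ∣ + ∣ q ∣
∣p∪q∣≤∣p∣+∣q∣ []          []          = z≤n
∣p∪q∣≤∣p∣+∣q∣ (true  ∷ p) (true  ∷ q) = s≤s (≤-trans (∣p∪q∣≤∣p∣+∣q∣ p q) (+-monoʳ-≤ ∣ p ∣ (n≤1+n ∣ q ∣)))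
∣p∪q∣≤∣p∣+∣q∣ (true  ∷ p) (false ∷ q) = s≤s (∣p∪q∣≤∣p∣+∣q∣ p q)
∣p∪q∣≤∣p∣+∣q∣ (false ∷ p) (true  ∷ q) = ≤-trans (s≤s (∣p∪q∣≤∣p∣+∣q∣ p q)) (≤-reflexive (sym (+-suc ∣ p ∣ ∣ q ∣)))
∣p∪q∣≤∣p∣+∣q∣ (false ∷ p) (false ∷ q) = ∣p∪q∣≤∣p∣+∣q∣ p q

pΔr⊆pΔq∪qΔr : ∀ {n} (p q r : Subset n) → p Δ r ⊆ (p Δ q) ∪ (q Δ r)
pΔr⊆pΔq∪qΔr []          []          []          = λ ()
pΔr⊆pΔq∪qΔr (true  ∷ p) (_     ∷ q) (true  ∷ r) = out⊆ (pΔr⊆pΔq∪qΔr p q r)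
pΔr⊆pΔq∪qΔr (false ∷ p) (_     ∷ q) (false ∷ r) = out⊆ (pΔr⊆pΔq∪qΔr p q r)
pΔr⊆pΔq∪qΔr (true  ∷ p) (true  ∷ q) (false ∷ r) = in⊆in (pΔr⊆pΔq∪qΔr p q r)
pΔr⊆pΔq∪qΔr (true  ∷ p) (false ∷ q) (false ∷ r) = in⊆in (pΔr⊆pΔq∪qΔr p q r)
pΔr⊆pΔq∪qΔr (false ∷ p) (true  ∷ q) (true  ∷ r) = in⊆in (pΔr⊆pΔq∪qΔr p q r)
pΔr⊆pΔq∪qΔr (false ∷ p) (false ∷ q) (true  ∷ r) = in⊆in (pΔr⊆pΔq∪qΔr p q r)

∣pΔr∣≤∣pΔq∣+∣qΔr∣ : ∀ {n} (p q r : Subset n) → ∣ p Δ r ∣ ≤ ∣ p Δ q ∣ + ∣ q Δ r ∣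
∣pΔr∣≤∣pΔq∣+∣qΔr∣ p q r =
  ≤-trans (p⊆q⇒∣p∣≤∣q∣ (pΔr⊆pΔq∪qΔr p q r)) (∣p∪q∣≤∣p∣+∣q∣ (p Δ q) (q Δ r))

∈-allSubsets : ∀ {n} (p : Subset n) → p ∈ allSubsets n
∈-allSubsets []          = here refl
∈-allSubsets (true  ∷ p) = ∈-++⁺ˡ (∈-map⁺ (true ∷_) (∈-allSubsets p))
∈-allSubsets (false ∷ p) = ∈-++⁺ʳ (map (true ∷_) (allSubsets _)) (∈-map⁺ (false ∷_) (∈-allSubsets p))

-- These are the folds by which rmax, rmin and ∂ωM are defined, so those
-- unfold to maxOf and minOf definitionally.
module _ {a} {A : Set a} (f : A → ℕ) where

  maxOf : List A → ℕ
  maxOf = foldr (λ x m → f x ⊔ m) 0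

  minOf : A → List A → ℕ
  minOf x = foldr (λ y m → f y ⊓ m) (f x)

  f≤maxOf : ∀ {x xs} → x ∈ xs → f x ≤ maxOf xs
  f≤maxOf {xs = y ∷ ys} (here refl)  = m≤m⊔n (f y) (maxOf ys)
  f≤maxOf {xs = y ∷ ys} (there x∈ys) = ≤-trans (f≤maxOf x∈ys) (m≤n⊔m (f y) (maxOf ys))

  maxOf-lub : ∀ {c} xs → (∀ {x} → x ∈ xs → f x ≤ c) → maxOf xs ≤ c
  maxOf-lub []       _     = z≤n
  maxOf-lub (x ∷ xs) f≤c = ⊔-lub (f≤c (here refl)) (maxOf-lub xs (f≤c ∘ there))

  minOf≤f : ∀ {x xs y} → y ∈ x ∷ xs → minOf x xs ≤ f y
  minOf≤f {xs = []}         (here refl)         = ≤-refl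
  minOf≤f {x} {xs = z ∷ zs} (here refl)         = ≤-trans (m⊓n≤n (f z) (minOf x zs)) (minOf≤f {xs = zs} (here refl))
  minOf≤f {x} {xs = z ∷ zs} (there (here refl)) = m⊓n≤m (f z) (minOf x zs)
  minOf≤f {x} {xs = z ∷ zs} (there (there y∈zs)) = ≤-trans (m⊓n≤n (f z) (minOf x zs)) (minOf≤f (there y∈zs))

  minOf-attained : ∀ x xs → ∃[ y ] (y ∈ x ∷ xs × f y ≡ minOf x xs)
  minOf-attained x xs with foldr-selective ⊓-sel (f x) (map f xs)
  ... | inj₁ ⊓≡fx = x , here refl , trans (sym ⊓≡fx) (foldr-map _⊓_ f (f x) xs)
  ... | inj₂ ⊓∈fxs with y , y∈xs , ⊓≡fy ← ∈-map⁻ f ⊓∈fxs =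
    y , there y∈xs , trans (sym ⊓≡fy) (foldr-map _⊓_ f (f x) xs)

  ∃-maximiser : ∀ {xs} → xs ≢ [] → ∃[ x ] (x ∈ xs × ∀ {y} → y ∈ xs → f y ≤ f x)
  ∃-maximiser {[]}     xs≢[] = ⊥-elim (xs≢[] refl)
  ∃-maximiser {x ∷ xs} _     = argmax f x xs , argmax-all f (here refl) (tabulate there) , maximal
    where
    maximal : ∀ {y} → y ∈ x ∷ xs → f y ≤ f (argmax f x xs)
    maximal (here refl)  = f[⊥]≤f[argmax] {f = f} x xs
    maximal (there y∈xs) = lookup (f[xs]≤f[argmax] {f = f} x xs) y∈xs

module _ {n : ℕ} where

  eccentricity : SetSystem n → Subset n → ℕ
  eccentricity D Y = maxOf (λ X → ∣ X Δ Y ∣) (feasible D)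

  eccentricity≤eccentricity+∣Δ∣ : ∀ (D : SetSystem n) Y A →
                                  eccentricity D A ≤ eccentricity D Y + ∣ Y Δ A ∣
  eccentricity≤eccentricity+∣Δ∣ D Y A = maxOf-lub (λ X → ∣ X Δ A ∣) (feasible D) λ {X} X∈D → begin
    ∣ X Δ A ∣                        ≤⟨ ∣pΔr∣≤∣pΔq∣+∣qΔr∣ X Y A ⟩
    ∣ X Δ Y ∣ + ∣ Y Δ A ∣            ≤⟨ +-monoˡ-≤ ∣ Y Δ A ∣ (f≤maxOf (λ Z → ∣ Z Δ Y ∣) X∈D) ⟩
    eccentricity D Y + ∣ Y Δ A ∣     ∎
    where open ≤-Reasoning

  rmax-twist : ∀ (D : SetSystem n) A → rmax (twist D A) ≡ eccentricity D A
  rmax-twist D A = foldr-map (λ X m → ∣ X ∣ ⊔ m) (_Δ A) 0 (feasible D)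

  ω-twist-feasible : ∀ (D : SetSystem n) {F} → F ∈ feasible D → ω (twist D F) ≡ eccentricity D F
  ω-twist-feasible D@(setSystem (_ ∷ _)) {F} F∈D = cong₂ _∸_ (rmax-twist D F) rmin≡0
    where
    rmin≡0 : rmin (twist D F) ≡ 0
    rmin≡0 = n≤0⇒n≡0 (≤-trans (minOf≤f ∣_∣ (∈-map⁺ (_Δ F) F∈D)) (≤-reflexive (∣pΔp∣≡0 F)))

  ω-twist≤eccentricity : ∀ (D : SetSystem n) → feasible D ≢ [] → ∀ A →
                         ∃[ Y ] (Y ∈ feasible D × ω (twist D A) ≤ eccentricity D Y)
  ω-twist≤eccentricity (setSystem []) []≢[] _ = ⊥-elim ([]≢[] refl)
  ω-twist≤eccentricity D@(setSystem (X ∷ Xs)) _ A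
    with Z , Z∈D+A , ∣Z∣≡rmin ← minOf-attained ∣_∣ (X Δ A) (map (_Δ A) Xs)
    with Y , Y∈D , refl ← ∈-map⁻ (_Δ A) {xs = X ∷ Xs} Z∈D+A = Y , Y∈D , (begin
      ω (twist D A)                                 ≡⟨ cong₂ _∸_ (rmax-twist D A) (sym ∣Z∣≡rmin) ⟩
      eccentricity D A ∸ ∣ Y Δ A ∣                  ≤⟨ ∸-monoˡ-≤ ∣ Y Δ A ∣ (eccentricity≤eccentricity+∣Δ∣ D Y A) ⟩
      eccentricity D Y + ∣ Y Δ A ∣ ∸ ∣ Y Δ A ∣      ≡⟨ m+n∸n≡m (eccentricity D Y) ∣ Y Δ A ∣ ⟩
      eccentricity D Y                              ∎)
    where open ≤-Reasoning

  ω-twist≤∂ωM : ∀ (D : SetSystem n) A → ω (twist D A) ≤ ∂ωM D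
  ω-twist≤∂ωM D A = f≤maxOf (ω ∘ twist D) (∈-allSubsets A)

  ∂ωM-lub : ∀ (D : SetSystem n) {c} → (∀ A → ω (twist D A) ≤ c) → ∂ωM D ≤ c
  ∂ωM-lub D ω≤c = maxOf-lub (ω ∘ twist D) (allSubsets n) λ {A} _ → ω≤c A

mainTheorem1 : (n : ℕ) (D : SetSystem n) → feasible D ≢ [] →
    ∃[ F ] (F ∈ feasible D × ω (twist D F) ≡ ∂ωM D)
mainTheorem1 n D D≢∅ with F , F∈D , F-maximal ← ∃-maximiser (eccentricity D) D≢∅ =
  F , F∈D , ≤-antisym (ω-twist≤∂ωM D F) (∂ωM-lub D ω-twist≤ω-twist-F)
  where
  ω-twist≤ω-twist-F : ∀ A → ω (twist D A) ≤ ω (twist D F)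
  ω-twist≤ω-twist-F A with Y , Y∈D , ω-twist≤ecc-Y ← ω-twist≤eccentricity D D≢∅ A = begin
    ω (twist D A)      ≤⟨ ω-twist≤ecc-Y ⟩
    eccentricity D Y   ≤⟨ F-maximal Y∈D ⟩
    eccentricity D F   ≡⟨ ω-twist-feasible D F∈D ⟨
    ω (twist D F)      ∎
    where open ≤-Reasoning
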